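{- Let $P$ be a finite poset. If $P$ has an automorphism with a cycle of length $2$, then $J(P)$ is $1/2$-balanced.
   Context: $J(P)$ is the distributive lattice of lower order ideals (down-closed subsets) of $P$ ordered by inclusion. An automorphism of $P$ is a bijection $\phi:P\to P$ with $x\le y$ iff $\phi(x)\le\phi(y)$; it has a cycle of length 2 if there are distinct $x,y$ with $\phi(x)=y$, $\phi(y)=x$. For distinct $x,y$ in a finite poset $Q$, $\mathbb{P}(x\prec y)$ is the proportion of linear extensions of $Q$ (total orders compatible with the partial order) in which $x$ comes before $y$. $Q$ is $1/2$-balanced if there are distinct $x,y\in Q$ with $\mathbb{P}(x\prec y)=1/2$. -}

module Defs where

open import Data.Nat using (ℕ; _*_)
open import Data.Fin using (Fin; _<_)
open import Data.Fin.Subset using (Subset; _⊆_) renaming (_∈_ to _∈ₛ_)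
open import Data.List using (List; length; lookup)
open import Data.List.Membership.Propositional using (_∈_)
open import Data.List.Relation.Unary.Unique.Propositional using (Unique)
open import Data.Product using (Σ; ∃; _×_)
open import Function.Bundles using (_⇔_)
open import Function.Definitions using (Bijective)
open import Relation.Nullary using (¬_)
open import Relation.Binary.PropositionalEquality using (_≡_)
open import Relation.Binary.Structures using (IsDecPartialOrder)

-- A finite poset: carrier Fin n with a decidable partial order _≤_
-- (decidability is automatic classically for a finite poset).
record FinPoset : Set₁ where
  field
    n       : ℕ
    _≤_     : Fin n → Fin n → Set
    isDPO   : IsDecPartialOrder _≡_ _≤_

module _ (P : FinPoset) where
  open FinPoset P

  IsAutomorphism : (Fin n → Fin n) → Set
  IsAutomorphism φ = Bijective _≡_ _≡_ φ × (∀ x y → (x ≤ y) ⇔ (φ x ≤ φ y))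

  HasTwoCycle : (Fin n → Fin n) → Set
  HasTwoCycle φ = Σ (Fin n) λ x → Σ (Fin n) λ y → ¬ (x ≡ y) × φ x ≡ y × φ y ≡ x

  -- lower order ideal (down-closed subset) of P; elements of J(P)
  IsIdeal : Subset n → Set
  IsIdeal S = ∀ x y → x ≤ y → y ∈ₛ S → x ∈ₛ S

Before : {A : Set} → List A → A → A → Set
Before L a b = Σ (Fin (length L)) λ i → Σ (Fin (length L)) λ j →
  i < j × lookup L i ≡ a × lookup L j ≡ b

module _ (P : FinPoset) where
  open FinPoset P

  IsLinExtJ : List (Subset n) → Set
  IsLinExtJ L = Unique L
              × (∀ S → (S ∈ L) ⇔ IsIdeal P S)
              × (∀ S T → IsIdeal P S → IsIdeal P T → S ⊆ T → ¬ (S ≡ T) → Before L S T)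

  Enumerates : (List (Subset n) → Set) → List (List (Subset n)) → Set
  Enumerates Q xs = Unique xs × (∀ L → (L ∈ xs) ⇔ Q L)

  -- P(I ≺ I') = 1/2 among linear extensions of J(P):
  -- #{L : I before I'} * 2 = #{L}
  ProbHalf : Subset n → Subset n → Set
  ProbHalf I I' = Σ (List (List (Subset n))) λ all → Σ (List (List (Subset n))) λ good →
      Enumerates IsLinExtJ all
    × Enumerates (λ L → IsLinExtJ L × Before L I I') good
    × 2 * length good ≡ length all

  JHalfBalanced : Set
  JHalfBalanced = Σ (Subset n) λ I → Σ (Subset n) λ I' →
    IsIdeal P I × IsIdeal P I' × ¬ (I ≡ I') × ProbHalf I I'

-- Pulling ideals back along an automorphism φ of P is an automorphism of J(P), so it acts
-- injectively on the linear extensions of J(P). If φ swaps x and y, it exchanges the principal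
-- ideals ↓x and ↓y; hence it maps the linear extensions placing ↓x before ↓y injectively into
-- those placing ↓y before ↓x, and vice versa, so both classes have the same size.
module Submission where

open import Defs
open import Data.Bool using (true; false) renaming (_≟_ to _≟ᴮ_)
open import Data.Fin using (Fin; zero; suc)
import Data.Fin.Properties as Fin
open import Data.Fin.Subset using (Subset; _⊆_) renaming (_∈_ to _∈ₛ_)
open import Data.Fin.Subset.Properties using (⊆-antisym) renaming (_∈?_ to _∈ₛ?_; _⊆?_ to _⊆ₛ?_)
open import Data.List using (List; []; _∷_; _++_; length; map; filter; concatMap; deduplicate)
open import Data.List.Properties using (length-map; length-++; map-injective) renaming (≡-dec to ≡-decᴸ)
open import Data.List.Membership.Propositional using (_∈_)
open import Data.List.Membership.Propositional.Properties
  using (∈-lookup; ∈-map⁺; ∈-map⁻; ∈-filter⁺; ∈-filter⁻; ∈-++⁺ˡ; ∈-++⁺ʳ; ∈-++⁻; ∈-∃++; ∈-concatMap⁺;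
         ∈-deduplicate⁺; ∈-deduplicate⁻)
open import Data.List.Relation.Binary.Subset.Propositional using () renaming (_⊆_ to _⊆ᴸ_)
import Data.List.Relation.Unary.All as All
open import Data.List.Relation.Unary.Any as Any using (here; there)
open import Data.List.Relation.Unary.Any.Properties using (lookup-index)
open import Data.List.Relation.Unary.Unique.Propositional using (Unique; []; _∷_)
import Data.List.Relation.Unary.Unique.Propositional.Properties as Unique
import Data.List.Relation.Unary.Unique.DecPropositional as DecUnique
import Data.List.Relation.Unary.Unique.DecPropositional.Properties as DecUnique
import Data.List.Membership.DecPropositional as DecMembership
open import Data.Nat using (ℕ; zero; suc; _+_; _*_; _≤_; z≤n; s≤s)
open import Data.Nat.Properties using (+-suc; +-identityʳ; ≤-antisym)
open import Data.Product using (∃; _×_; _,_; proj₁; proj₂)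
open import Data.Sum using (_⊎_; inj₁; inj₂)
open import Data.Vec using ([]; _∷_; tabulate)
open import Data.Vec.Properties using (lookup∘tabulate; []=⇒lookup; lookup⇒[]=) renaming (≡-dec to ≡-decⱽ)
open import Function using (_∘_)
open import Function.Bundles using (_⇔_; mk⇔; module Equivalence)
open import Function.Definitions using (Injective)
open import Function.Consequences.Propositional using (inverseʳ⇒injective; strictlyInverseʳ⇒inverseʳ)
open import Relation.Nullary using (¬_; Dec; yes; no; does; proof; ¬?; contradiction)
open import Relation.Nullary.Reflects using (Reflects; invert)
open import Relation.Nullary.Decidable using (_×-dec_; _⊎-dec_; _→-dec_; map′; dec-true)
open import Relation.Binary.Definitions using (DecidableEquality)
open import Relation.Binary.PropositionalEquality using (_≡_; _≢_; refl; sym; trans; cong; subst; subst₂; module ≡-Reasoning)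
open import Relation.Binary.Structures using (IsDecPartialOrder)
open import Relation.Unary using (Decidable)
open import Relation.Unary.Properties using (∁?)

open Equivalence using (to; from)

injective-by-left-inverse : {A B : Set} (f : A → B) (g : B → A) → (∀ x → g (f x) ≡ x) → Injective _≡_ _≡_ f
injective-by-left-inverse f g g∘f = inverseʳ⇒injective f (strictlyInverseʳ⇒inverseʳ {f⁻¹ = g} f g∘f)

_⇔-dec_ : {A B : Set} → Dec A → Dec B → Dec (A ⇔ B)
a? ⇔-dec b? = map′ (λ (f , g) → mk⇔ f g) (λ e → to e , from e) ((a? →-dec b?) ×-dec (b? →-dec a?))

module _ {A : Set} where

  before-∷ : ∀ {a b : A} {xs} → b ∈ xs → Before (a ∷ xs) a b
  before-∷ b∈xs = zero , suc (Any.index b∈xs) , s≤s z≤n , refl , sym (lookup-index b∈xs)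

  before-there : ∀ {a b x : A} {xs} → Before xs a b → Before (x ∷ xs) a b
  before-there (i , j , i<j , xsᵢ≡a , xsⱼ≡b) = suc i , suc j , s≤s i<j , xsᵢ≡a , xsⱼ≡b

  before-uncons : ∀ {a b x : A} {xs} → Before (x ∷ xs) a b → (x ≡ a × b ∈ xs) ⊎ Before xs a b
  before-uncons (zero , suc j , _ , x≡a , xsⱼ≡b) = inj₁ (x≡a , subst (_∈ _) xsⱼ≡b (∈-lookup j))
  before-uncons (suc i , suc j , s≤s i<j , xsᵢ≡a , xsⱼ≡b) = inj₂ (i , j , i<j , xsᵢ≡a , xsⱼ≡b)

  before⇒∈ʳ : ∀ {a b : A} {xs} → Before xs a b → b ∈ xs
  before⇒∈ʳ (_ , j , _ , _ , xsⱼ≡b) = subst (_∈ _) xsⱼ≡b (∈-lookup j)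

  before? : DecidableEquality A → ∀ xs (a b : A) → Dec (Before xs a b)
  before? _≟_ [] a b = no λ ()
  before? _≟_ (x ∷ xs) a b =
    map′ cons before-uncons (((x ≟ a) ×-dec (b ∈? xs)) ⊎-dec before? _≟_ xs a b)
    where
    open DecMembership _≟_ using (_∈?_)
    cons : (x ≡ a × b ∈ xs) ⊎ Before xs a b → Before (x ∷ xs) a b
    cons (inj₁ (refl , b∈xs)) = before-∷ b∈xs
    cons (inj₂ b) = before-there b

  before-total : ∀ {a b : A} {xs} → a ∈ xs → b ∈ xs → a ≢ b → Before xs a b ⊎ Before xs b a
  before-total (here refl) (here refl) a≢b = contradiction refl a≢b
  before-total (here refl) (there b∈xs) _ = inj₁ (before-∷ b∈xs)
  before-total (there a∈xs) (here refl) _ = inj₂ (before-∷ a∈xs)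
  before-total (there a∈xs) (there b∈xs) a≢b with before-total a∈xs b∈xs a≢b
  ... | inj₁ ab = inj₁ (before-there ab)
  ... | inj₂ ba = inj₂ (before-there ba)

  before-asym : ∀ {a b : A} {xs} → Unique xs → Before xs a b → ¬ Before xs b a
  before-asym {xs = x ∷ xs} (x∉xs ∷ u) ab ba with before-uncons ab | before-uncons ba
  ... | inj₁ (refl , b∈xs) | inj₁ (refl , _) = All.lookup x∉xs b∈xs refl
  ... | inj₁ (refl , _) | inj₂ ba′ = All.lookup x∉xs (before⇒∈ʳ ba′) refl
  ... | inj₂ ab′ | inj₁ (refl , _) = All.lookup x∉xs (before⇒∈ʳ ab′) refl
  ... | inj₂ ab′ | inj₂ ba′ = before-asym u ab′ ba′

module _ {A B : Set} where

  before-map : (f : A → B) {a b : A} (xs : List A) → Before xs a b → Before (map f xs) (f a) (f b)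
  before-map f (x ∷ xs) ab with before-uncons ab
  ... | inj₁ (refl , b∈xs) = before-∷ (∈-map⁺ f b∈xs)
  ... | inj₂ ab′ = before-there (before-map f xs ab′)

module _ {A : Set} where

  ∈-++-∷⁻ : ∀ {z y : A} xs {ys} → z ∈ xs ++ y ∷ ys → z ≢ y → z ∈ xs ++ ys
  ∈-++-∷⁻ xs m z≢y with ∈-++⁻ xs m
  ... | inj₁ z∈xs = ∈-++⁺ˡ z∈xs
  ... | inj₂ (here z≡y) = contradiction z≡y z≢y
  ... | inj₂ (there z∈ys) = ∈-++⁺ʳ xs z∈ys

  unique-⊆⇒length-≤ : ∀ {xs ys : List A} → Unique ys → ys ⊆ᴸ xs → length ys ≤ length xs
  unique-⊆⇒length-≤ {ys = []} [] _ = z≤n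
  unique-⊆⇒length-≤ {ys = y ∷ ys} (y∉ys ∷ u) ys⊆xs with ∈-∃++ (ys⊆xs (here refl))
  ... | xs₁ , xs₂ , refl
    rewrite length-++ xs₁ {y ∷ xs₂} | +-suc (length xs₁) (length xs₂) | sym (length-++ xs₁ {xs₂}) =
    s≤s (unique-⊆⇒length-≤ u λ z∈ys →
      ∈-++-∷⁻ xs₁ (ys⊆xs (there z∈ys)) λ z≡y → All.lookup y∉ys z∈ys (sym z≡y))

module _ {A : Set} {B C : A → Set} (B? : Decidable B) (C? : Decidable C) where

  length-filter-≤-by-injection : (f : A → A) → Injective _≡_ _≡_ f → ∀ {xs} → Unique xs →
    (∀ {x} → x ∈ xs → f x ∈ xs) → (∀ {x} → x ∈ xs → B x → C (f x)) →
    length (filter B? xs) ≤ length (filter C? xs)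
  length-filter-≤-by-injection f f-inj {xs} u closed B⇒C =
    subst (_≤ length (filter C? xs)) (length-map f (filter B? xs))
      (unique-⊆⇒length-≤ (Unique.map⁺ f-inj (Unique.filter⁺ B? u)) image⊆)
    where
    image⊆ : map f (filter B? xs) ⊆ᴸ filter C? xs
    image⊆ m with ∈-map⁻ f m
    ... | x , x∈ , refl with ∈-filter⁻ B? x∈
    ... | x∈xs , Bx = ∈-filter⁺ C? (closed x∈xs) (B⇒C x∈xs Bx)

module _ {A : Set} {B : A → Set} (B? : Decidable B) where

  length-filter-+-∁ : ∀ xs → length (filter B? xs) + length (filter (∁? B?) xs) ≡ length xs
  length-filter-+-∁ [] = refl
  length-filter-+-∁ (x ∷ xs) with B? x
  ... | yes _ = cong suc (length-filter-+-∁ xs)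
  ... | no _ = trans (+-suc _ _) (cong suc (length-filter-+-∁ xs))

  2*length-filter-by-toggle : (f : A → A) → Injective _≡_ _≡_ f → ∀ {xs} → Unique xs →
    (∀ {x} → x ∈ xs → f x ∈ xs) → (∀ {x} → x ∈ xs → B x → ¬ B (f x)) →
    (∀ {x} → x ∈ xs → ¬ B x → B (f x)) → 2 * length (filter B? xs) ≡ length xs
  2*length-filter-by-toggle f f-inj {xs} u closed B⇒¬B ¬B⇒B = begin
    2 * yes#          ≡⟨ cong (yes# +_) (+-identityʳ yes#) ⟩
    yes# + yes#       ≡⟨ cong (yes# +_) (≤-antisym
                           (length-filter-≤-by-injection B? (∁? B?) f f-inj u closed B⇒¬B)
                           (length-filter-≤-by-injection (∁? B?) B? f f-inj u closed ¬B⇒B)) ⟩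
    yes# + no#        ≡⟨ length-filter-+-∁ xs ⟩
    length xs         ∎
    where
    open ≡-Reasoning
    yes# = length (filter B? xs)
    no# = length (filter (∁? B?) xs)

Enumeration : {A : Set} → (A → Set) → List A → Set
Enumeration Q xs = Unique xs × (∀ x → (x ∈ xs) ⇔ Q x)

enumeration-filter : {A : Set} {Q B : A → Set} (B? : Decidable B) {xs : List A} →
  Enumeration Q xs → Enumeration (λ x → Q x × B x) (filter B? xs)
enumeration-filter B? (u , ∈⇔Q) = Unique.filter⁺ B? u , λ x → mk⇔
  (λ m → let x∈xs , Bx = ∈-filter⁻ B? m in to (∈⇔Q x) x∈xs , Bx)
  (λ (Qx , Bx) → ∈-filter⁺ B? (from (∈⇔Q x) Qx) Bx)

module Finite {A : Set} (_≟_ : DecidableEquality A) (elements : List A) (∈-elements : ∀ x → x ∈ elements) where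

  all? : {Q : A → Set} → Decidable Q → Dec (∀ x → Q x)
  all? Q? = map′ (λ all x → All.lookup all (∈-elements x)) (λ ∀Q → All.tabulate λ {x} _ → ∀Q x)
                 (All.all? Q? elements)

  listsOfLength≤ : ℕ → List (List A)
  listsOfLength≤ zero = [] ∷ []
  listsOfLength≤ (suc k) = [] ∷ concatMap (λ x → map (x ∷_) (listsOfLength≤ k)) elements

  ∈-listsOfLength≤ : ∀ k xs → length xs ≤ k → xs ∈ listsOfLength≤ k
  ∈-listsOfLength≤ zero [] _ = here refl
  ∈-listsOfLength≤ (suc k) [] _ = here refl
  ∈-listsOfLength≤ (suc k) (x ∷ xs) (s≤s |xs|≤k) = there (∈-concatMap⁺ (λ e → map (e ∷_) (listsOfLength≤ k))
    (Any.map (λ { refl → ∈-map⁺ (x ∷_) (∈-listsOfLength≤ k xs |xs|≤k) }) (∈-elements x)))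

  -- Unique lists have length at most |elements|, so finitely many lists satisfy Q.
  enumerate : {Q : List A → Set} → Decidable Q → (∀ {xs} → Q xs → Unique xs) → ∃ (Enumeration Q)
  enumerate {Q} Q? Q⇒unique = deduplicate _≟ᴸ_ candidates , DecUnique.deduplicate-! _≟ᴸ_ candidates ,
    λ xs → mk⇔ (λ m → proj₂ (∈-filter⁻ Q? {xs = short} (∈-deduplicate⁻ _≟ᴸ_ candidates m)))
                (λ Qxs → ∈-deduplicate⁺ _≟ᴸ_ (complete Qxs))
    where
    _≟ᴸ_ = ≡-decᴸ _≟_
    short = listsOfLength≤ (length elements)
    candidates = filter Q? short
    complete : ∀ {xs} → Q xs → xs ∈ candidates
    complete {xs} Qxs = ∈-filter⁺ Q? (∈-listsOfLength≤ (length elements) xs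
      (unique-⊆⇒length-≤ (Q⇒unique Qxs) (λ {x} _ → ∈-elements x))) Qxs

allSubsets : ∀ n → List (Subset n)
allSubsets zero = [] ∷ []
allSubsets (suc n) = map (true ∷_) (allSubsets n) ++ map (false ∷_) (allSubsets n)

∈-allSubsets : ∀ {n} (S : Subset n) → S ∈ allSubsets n
∈-allSubsets [] = here refl
∈-allSubsets (true ∷ S) = ∈-++⁺ˡ (∈-map⁺ (true ∷_) (∈-allSubsets S))
∈-allSubsets {suc n} (false ∷ S) = ∈-++⁺ʳ (map (true ∷_) (allSubsets n)) (∈-map⁺ (false ∷_) (∈-allSubsets S))

_≟ˢ_ : ∀ {n} → DecidableEquality (Subset n)
_≟ˢ_ = ≡-decⱽ _≟ᴮ_

module Subsets (n : ℕ) = Finite _≟ˢ_ (allSubsets n) ∈-allSubsets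

subsetOf : ∀ {n} {Q : Fin n → Set} → Decidable Q → Subset n
subsetOf Q? = tabulate (does ∘ Q?)

∈-subsetOf : ∀ {n} {Q : Fin n → Set} (Q? : Decidable Q) {z} → z ∈ₛ subsetOf Q? ⇔ Q z
∈-subsetOf {Q = Q} Q? {z} = mk⇔
  (λ z∈ → invert (subst (Reflects (Q z)) (trans (sym (lookup∘tabulate (does ∘ Q?) z)) ([]=⇒lookup z∈)) (proof (Q? z))))
  (λ Qz → lookup⇒[]= z _ (trans (lookup∘tabulate (does ∘ Q?) z) (dec-true (Q? z) Qz)))

preimage : ∀ {n} → (Fin n → Fin n) → Subset n → Subset n
preimage f S = subsetOf (λ z → f z ∈ₛ? S)

∈-preimage : ∀ {n} (f : Fin n → Fin n) S {z} → z ∈ₛ preimage f S ⇔ f z ∈ₛ S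
∈-preimage f S = ∈-subsetOf (λ z → f z ∈ₛ? S)

preimage-mono : ∀ {n} (f : Fin n → Fin n) {S T} → S ⊆ T → preimage f S ⊆ preimage f T
preimage-mono f {S} {T} S⊆T z∈ = from (∈-preimage f T) (S⊆T (to (∈-preimage f S) z∈))

preimage-inverse : ∀ {n} (f g : Fin n → Fin n) → (∀ z → g (f z) ≡ z) → ∀ S → preimage f (preimage g S) ≡ S
preimage-inverse f g g∘f S = ⊆-antisym
  (λ {z} z∈ → subst (_∈ₛ S) (g∘f z) (to (∈-preimage g S) (to (∈-preimage f (preimage g S)) z∈)))
  (λ {z} z∈ → from (∈-preimage f (preimage g S)) (from (∈-preimage g S) (subst (_∈ₛ S) (sym (g∘f z)) z∈)))

module _ (P : FinPoset) where
  open FinPoset P renaming (_≤_ to _⊑_)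
  open IsDecPartialOrder isDPO using () renaming (_≤?_ to _⊑?_; refl to ⊑-refl; trans to ⊑-trans; antisym to ⊑-antisym)

  ↓ : Fin n → Subset n
  ↓ x = subsetOf (_⊑? x)

  ↓-isIdeal : ∀ x → IsIdeal P (↓ x)
  ↓-isIdeal x a b a⊑b b∈ = from (∈-subsetOf (_⊑? x)) (⊑-trans a⊑b (to (∈-subsetOf (_⊑? x)) b∈))

  ↓-injective : ∀ {x y} → ↓ x ≡ ↓ y → x ≡ y
  ↓-injective {x} {y} ↓x≡↓y = ⊑-antisym
    (to (∈-subsetOf (_⊑? y)) (subst (x ∈ₛ_) ↓x≡↓y (from (∈-subsetOf (_⊑? x)) ⊑-refl)))
    (to (∈-subsetOf (_⊑? x)) (subst (y ∈ₛ_) (sym ↓x≡↓y) (from (∈-subsetOf (_⊑? y)) ⊑-refl)))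

  preimage-↓ : (f : Fin n → Fin n) → (∀ a b → (a ⊑ b) ⇔ (f a ⊑ f b)) → ∀ x → preimage f (↓ (f x)) ≡ ↓ x
  preimage-↓ f f-embedding x = ⊆-antisym
    (λ {z} z∈ → from (∈-subsetOf (_⊑? x))
      (from (f-embedding z x) (to (∈-subsetOf (_⊑? f x)) (to (∈-preimage f (↓ (f x))) z∈))))
    (λ {z} z∈ → from (∈-preimage f (↓ (f x)))
      (from (∈-subsetOf (_⊑? f x)) (to (f-embedding z x) (to (∈-subsetOf (_⊑? x)) z∈))))

  preimage-isIdeal : (f : Fin n → Fin n) → (∀ a b → a ⊑ b → f a ⊑ f b) →
    ∀ S → IsIdeal P S → IsIdeal P (preimage f S)
  preimage-isIdeal f f-mono S S-ideal a b a⊑b b∈ =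
    from (∈-preimage f S) (S-ideal (f a) (f b) (f-mono a b a⊑b) (to (∈-preimage f S) b∈))

  isIdeal? : Decidable (IsIdeal P)
  isIdeal? S = Fin.all? λ x → Fin.all? λ y → (x ⊑? y) →-dec ((y ∈ₛ? S) →-dec (x ∈ₛ? S))

  isLinExtJ? : Decidable (IsLinExtJ P)
  isLinExtJ? L = DecUnique.unique? _≟ˢ_ L
    ×-dec all? (λ S → (S ∈? L) ⇔-dec isIdeal? S)
    ×-dec all? λ S → all? λ T → isIdeal? S →-dec (isIdeal? T →-dec
            ((S ⊆ₛ? T) →-dec (¬? (S ≟ˢ T) →-dec before? _≟ˢ_ L S T)))
    where
    open Subsets n using (all?)
    open DecMembership _≟ˢ_ using (_∈?_)

  isLinExtJ-connex : ∀ {L I J} → IsLinExtJ P L → IsIdeal P I → IsIdeal P J → I ≢ J →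
    ¬ Before L I J → Before L J I
  isLinExtJ-connex (_ , ∈L⇔ideal , _) I-ideal J-ideal I≢J ¬IJ
    with before-total (from (∈L⇔ideal _) I-ideal) (from (∈L⇔ideal _) J-ideal) I≢J
  ... | inj₁ IJ = contradiction IJ ¬IJ
  ... | inj₂ JI = JI

  linearExtensionsJ : ∃ (Enumeration (IsLinExtJ P))
  linearExtensionsJ = Subsets.enumerate n isLinExtJ? proj₁

  module _ (F G : Subset n → Subset n) (F∘G : ∀ S → F (G S) ≡ S) (G∘F : ∀ S → G (F S) ≡ S)
           (F-ideal : ∀ S → IsIdeal P S → IsIdeal P (F S)) (G-ideal : ∀ S → IsIdeal P S → IsIdeal P (G S))
           (G-mono : ∀ {S T} → S ⊆ T → G S ⊆ G T) where

    map-isLinExtJ : ∀ {L} → IsLinExtJ P L → IsLinExtJ P (map F L)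
    map-isLinExtJ {L} (u , ∈L⇔ideal , ordered) = Unique.map⁺ (injective-by-left-inverse F G G∘F) u ,
      ∈F[L]⇔ideal , F[L]-ordered
      where
      ∈F[L]⇔ideal : ∀ S → (S ∈ map F L) ⇔ IsIdeal P S
      ∈F[L]⇔ideal S = mk⇔
        (λ m → let T , T∈L , S≡FT = ∈-map⁻ F m in subst (IsIdeal P) (sym S≡FT) (F-ideal T (to (∈L⇔ideal T) T∈L)))
        (λ S-ideal → subst (_∈ map F L) (F∘G S) (∈-map⁺ F (from (∈L⇔ideal (G S)) (G-ideal S S-ideal))))
      F[L]-ordered : ∀ S T → IsIdeal P S → IsIdeal P T → S ⊆ T → ¬ (S ≡ T) → Before (map F L) S T
      F[L]-ordered S T S-ideal T-ideal S⊆T S≢T = subst₂ (Before (map F L)) (F∘G S) (F∘G T)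
        (before-map F L (ordered (G S) (G T) (G-ideal S S-ideal) (G-ideal T T-ideal) (G-mono S⊆T)
          (λ GS≡GT → S≢T (trans (sym (F∘G S)) (trans (cong F GS≡GT) (F∘G T))))))

module Automorphism (P : FinPoset) (φ : Fin (FinPoset.n P) → Fin (FinPoset.n P)) (aut : IsAutomorphism P φ) where
  open FinPoset P renaming (_≤_ to _⊑_)

  φ-injective : Injective _≡_ _≡_ φ
  φ-injective = proj₁ (proj₁ aut)

  φ-embedding : ∀ a b → (a ⊑ b) ⇔ (φ a ⊑ φ b)
  φ-embedding = proj₂ aut

  φ⁻¹ : Fin n → Fin n
  φ⁻¹ w = proj₁ (proj₂ (proj₁ aut) w)

  φ∘φ⁻¹ : ∀ w → φ (φ⁻¹ w) ≡ w
  φ∘φ⁻¹ w = proj₂ (proj₂ (proj₁ aut) w) refl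

  φ⁻¹∘φ : ∀ z → φ⁻¹ (φ z) ≡ z
  φ⁻¹∘φ z = φ-injective (φ∘φ⁻¹ (φ z))

  φ⁻¹-mono : ∀ a b → a ⊑ b → φ⁻¹ a ⊑ φ⁻¹ b
  φ⁻¹-mono a b a⊑b =
    from (φ-embedding (φ⁻¹ a) (φ⁻¹ b)) (subst₂ _⊑_ (sym (φ∘φ⁻¹ a)) (sym (φ∘φ⁻¹ b)) a⊑b)

  pullback : Subset n → Subset n
  pullback = preimage φ

  pullback-↓ : ∀ {a b} → φ a ≡ b → pullback (↓ P b) ≡ ↓ P a
  pullback-↓ {a} refl = preimage-↓ P φ φ-embedding a

  pullbackᴸ : List (Subset n) → List (Subset n)
  pullbackᴸ = map pullback

  pullbackᴸ-isLinExtJ : ∀ {L} → IsLinExtJ P L → IsLinExtJ P (pullbackᴸ L)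
  pullbackᴸ-isLinExtJ = map-isLinExtJ P pullback (preimage φ⁻¹)
    (preimage-inverse φ φ⁻¹ φ⁻¹∘φ) (preimage-inverse φ⁻¹ φ φ∘φ⁻¹)
    (preimage-isIdeal P φ (λ a b → to (φ-embedding a b))) (preimage-isIdeal P φ⁻¹ φ⁻¹-mono)
    (preimage-mono φ⁻¹)

  pullbackᴸ-injective : Injective _≡_ _≡_ pullbackᴸ
  pullbackᴸ-injective =
    map-injective (injective-by-left-inverse pullback (preimage φ⁻¹) (preimage-inverse φ⁻¹ φ φ∘φ⁻¹))

  probHalf-↓ : ∀ {x y} → x ≢ y → φ x ≡ y → φ y ≡ x → ProbHalf P (↓ P x) (↓ P y)
  probHalf-↓ {x} {y} x≢y φx≡y φy≡x = Ls , filter B? Ls , enum , enumeration-filter B? enum ,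
    2*length-filter-by-toggle B? pullbackᴸ pullbackᴸ-injective (proj₁ enum)
      (λ L∈ → from (proj₂ enum _) (pullbackᴸ-isLinExtJ (linExt L∈)))
      (λ {L} L∈ xy → before-asym (proj₁ (pullbackᴸ-isLinExtJ (linExt L∈))) (swap L φy≡x φx≡y xy))
      (λ {L} L∈ ¬xy → swap L φx≡y φy≡x
        (isLinExtJ-connex P (linExt L∈) (↓-isIdeal P x) (↓-isIdeal P y) ↓x≢↓y ¬xy))
    where
    Ls = proj₁ (linearExtensionsJ P)
    enum = proj₂ (linearExtensionsJ P)
    B? : Decidable (λ L → Before L (↓ P x) (↓ P y))
    B? L = before? _≟ˢ_ L (↓ P x) (↓ P y)
    linExt : ∀ {L} → L ∈ Ls → IsLinExtJ P L
    linExt {L} = to (proj₂ enum L)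
    swap : ∀ {a b} L → φ b ≡ a → φ a ≡ b →
      Before L (↓ P a) (↓ P b) → Before (pullbackᴸ L) (↓ P b) (↓ P a)
    swap {a} {b} L φb≡a φa≡b =
      subst₂ (Before (pullbackᴸ L)) (pullback-↓ φb≡a) (pullback-↓ φa≡b) ∘ before-map pullback L
    ↓x≢↓y : ↓ P x ≢ ↓ P y
    ↓x≢↓y = x≢y ∘ ↓-injective P

proposition3p4 : (P : FinPoset) (φ : Fin (FinPoset.n P) → Fin (FinPoset.n P)) →
    IsAutomorphism P φ → HasTwoCycle P φ → JHalfBalanced P
proposition3p4 P φ aut (x , y , x≢y , φx≡y , φy≡x) =
  ↓ P x , ↓ P y , ↓-isIdeal P x , ↓-isIdeal P y , x≢y ∘ ↓-injective P ,
  Automorphism.probHalf-↓ P φ aut x≢y φx≡y φy≡x
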